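{- Let $H$ be an ambi-nut digraph and let $\widetilde{\mathbf{x}}\in\operatorname{Ker}H$ be a non-trivial vector. Let $(u_1,u_2)$ be an arc of $H$ with $\widetilde{\mathbf{x}}(u_1)=\widetilde{\mathbf{x}}(u_2)$. Let $G$ be the digraph with vertex set $V(H)\cup\{u_0\}$ ($u_0$ a new vertex) and arc set $(E(H)\setminus\{(u_1,u_2)\})\cup\{(u_1,u_0),(u_0,u_2)\}$. Then $(G,u_0)$ is a gadget with $\operatorname{dem}(G,u_0)=-1$.
   Context: A digraph $G$ is a finite nonempty vertex set $V(G)$ with an arbitrary binary relation $\to$ (arc set $E(G)$); $G^+(v)=\{u:v\to u\}$. The adjacency matrix $A(G)$ has entry $1$ in position $(v,u)$ iff $v\to u$; $\operatorname{Ker}G=\ker A(G)$, $\operatorname{CoKer}G=\ker A(G)^\intercal$. A vector is full if it has no zero entry. $G$ is ambi-nut if $\operatorname{Ker}G$ and $\operatorname{CoKer}G$ are both one-dimensional and spanned by the same full vector. The reverse digraph $G^R$ satisfies $A(G^R)=A(G)^\intercal$; $M_{(r)}$ denotes $M$ with the row indexed by $r$ deleted. A gadget is a pair $(G,r)$, $r\in V(G)$, such that there is a full vector $\mathbf{x}$ spanning both $\ker A(G)_{(r)}$ and $\ker A(G^R)_{(r)}$ (each one-dimensional); its demand is $\operatorname{dem}(G,r)=-\big(\sum_{u\in G^+(r)}\mathbf{x}(u)\big)/\mathbf{x}(r)$. -}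

module Defs where

open import Data.Nat using (ℕ; zero; suc)
open import Data.Fin using (Fin; zero; suc; _≟_)
open import Data.Bool using (Bool; true; false; if_then_else_; _∧_; not)
open import Data.Rational using (ℚ; 0ℚ; _+_; _*_; -_; _÷_; ≢-nonZero)
open import Data.Product using (Σ; ∃; _×_; _,_)
open import Relation.Nullary using (¬_; does)
open import Relation.Binary.PropositionalEquality using (_≡_; _≢_)

-- A digraph on vertex set Fin n, given by its (0/1) adjacency relation:
-- adj v u ≡ true  iff  v → u.  Loops are allowed (arbitrary relation).
Digraph : ℕ → Set
Digraph n = Fin n → Fin n → Bool

Vector : ℕ → Set
Vector n = Fin n → ℚ

∑ : ∀ {n} → (Fin n → ℚ) → ℚ
∑ {zero}  f = 0ℚ
∑ {suc n} f = f zero + ∑ (λ i → f (suc i))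

reverse : ∀ {n} → Digraph n → Digraph n
reverse G v u = G u v

applyAdj : ∀ {n} → Digraph n → Vector n → Vector n
applyAdj G x v = ∑ (λ u → if G v u then x u else 0ℚ)

InKer : ∀ {n} → Digraph n → Vector n → Set
InKer G x = ∀ v → applyAdj G x v ≡ 0ℚ

InCoKer : ∀ {n} → Digraph n → Vector n → Set
InCoKer G x = InKer (reverse G) x

InKerDel : ∀ {n} → Digraph n → Fin n → Vector n → Set
InKerDel G r x = ∀ v → v ≢ r → applyAdj G x v ≡ 0ℚ

Full : ∀ {n} → Vector n → Set
Full x = ∀ v → x v ≢ 0ℚ

-- Together with x full (hence
-- nonzero on a nonempty vertex set) this says P is one-dimensional
-- and spanned by x.
SpannedBy : ∀ {n} → (Vector n → Set) → Vector n → Set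
SpannedBy {n} P x = P x × (∀ y → P y → ∃ λ (c : ℚ) → ∀ v → y v ≡ c * x v)

AmbiNut : ∀ {n} → Digraph n → Set
AmbiNut G = ∃ λ x → Full x × SpannedBy (InKer G) x × SpannedBy (InCoKer G) x

GadgetVector : ∀ {n} → Digraph n → Fin n → Vector n → Set
GadgetVector G r x =
  Full x × SpannedBy (InKerDel G r) x × SpannedBy (InKerDel (reverse G) r) x

IsGadget : ∀ {n} → Digraph n → Fin n → Set
IsGadget G r = ∃ λ x → GadgetVector G r x

dem : ∀ {n} → Digraph n → (r : Fin n) → (x : Vector n) → x r ≢ 0ℚ → ℚ
dem G r x nz = - (_÷_ (applyAdj G x r) (x r) {{≢-nonZero nz}})

-- The subdivided digraph: vertex set Fin (suc n), new vertex u0 = zero,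
-- old vertex v of H becomes suc v.  Arcs: those of H except (u1,u2),
-- plus (u1,u0) and (u0,u2).
subdivide : ∀ {n} → Digraph n → Fin n → Fin n → Digraph (suc n)
subdivide H u1 u2 zero    zero    = false
subdivide H u1 u2 zero    (suc w) = does (w ≟ u2)
subdivide H u1 u2 (suc v) zero    = does (v ≟ u1)
subdivide H u1 u2 (suc v) (suc w) = H v w ∧ not (does (v ≟ u1) ∧ does (w ≟ u2))

{-# OPTIONS --safe #-}
-- Let x be the full vector spanning both Ker H and CoKer H.  A vector z with
-- A(G)_(u₀) z = 0 restricts to a vector on V(H) satisfying every equation of
-- A(H) except possibly row u₁; since xᵀ A(H) = 0 and x(u₁) ≠ 0, that row holds
-- as well, so z restricts to a multiple of x, and row u₁ of G forces
-- z(u₀) = z(u₂).  Conversely x extended by x(u₂) at u₀ satisfies all rows but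
-- u₀, so it spans ker A(G)_(u₀).  The reverse of G is the subdivision of H^R
-- at (u₂, u₁), and x(u₁) = x(u₂) because x̃ is a nonzero multiple of x, so the
-- same argument applies to G^R with the same vector.  Finally row u₀ of G
-- reads A(G) z (u₀) = z(u₂) = z(u₀), which is demand -1.
module Submission where

open import Defs
open import Data.Nat using (ℕ; suc)
open import Data.Fin using (Fin; zero; suc; _≟_)
open import Data.Fin.Properties using (punchInᵢ≢i)
open import Data.Vec.Functional using (_∷_; tail; removeAt; replicate)
open import Data.Bool using (true; false; if_then_else_; _∧_; not)
open import Data.Bool.Properties using (∧-comm; ∧-identityʳ; ∧-zeroʳ)
open import Data.Rational using (ℚ; 0ℚ; 1ℚ; -_; _+_; _*_; _÷_; 1/_; ≢-nonZero)
open import Data.Rational.Properties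
  using (+-identityˡ; +-identityʳ; +-assoc; *-zeroˡ; *-zeroʳ; *-identityˡ; *-assoc;
         *-inverseˡ; *-inverseʳ; +-0-group; +-0-commutativeMonoid; +-*-commutativeRing)
open import Algebra.Bundles using (CommutativeMonoid; CommutativeRing)
open import Algebra.Properties.CommutativeSemigroup (CommutativeMonoid.commutativeSemigroup +-0-commutativeMonoid)
  using (xy∙z≈zy∙x)
open import Algebra.Properties.Group +-0-group using (identityˡ-unique)
open import Algebra.Properties.Semiring.Sum (CommutativeRing.semiring +-*-commutativeRing)
  using (sum; sum-cong-≗; sum-replicate-zero; sum-remove; *-distribˡ-sum; *-distribʳ-sum)
  renaming (∑-comm to sum-comm)
open import Data.Product using (∃; _×_; _,_; proj₁; proj₂)
open import Relation.Nullary using (Dec; yes; no; does; contradiction)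
open import Relation.Nullary.Decidable using (dec-true; dec-false)
open import Relation.Binary.PropositionalEquality
open ≡-Reasoning

∑≡sum : ∀ {n} (f : Fin n → ℚ) → ∑ f ≡ sum f
∑≡sum {ℕ.zero} f = refl
∑≡sum {suc n}  f = cong (f zero +_) (∑≡sum (λ i → f (suc i)))

∑-cong : ∀ {n} {f g : Fin n → ℚ} → f ≗ g → ∑ f ≡ ∑ g
∑-cong {f = f} {g} f≗g = begin
  ∑ f   ≡⟨ ∑≡sum f ⟩
  sum f ≡⟨ sum-cong-≗ f≗g ⟩
  sum g ≡⟨ ∑≡sum g ⟨
  ∑ g   ∎

∑-zero : ∀ {n} {f : Fin n → ℚ} → (∀ i → f i ≡ 0ℚ) → ∑ f ≡ 0ℚ
∑-zero {n} {f} f≗0 = begin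
  ∑ f                  ≡⟨ ∑-cong f≗0 ⟩
  ∑ (replicate n 0ℚ)   ≡⟨ ∑≡sum (replicate n 0ℚ) ⟩
  sum (replicate n 0ℚ) ≡⟨ sum-replicate-zero n ⟩
  0ℚ                   ∎

∑-remove : ∀ {n} (f : Fin (suc n) → ℚ) k → ∑ f ≡ f k + ∑ (removeAt f k)
∑-remove f k = begin
  ∑ f                         ≡⟨ ∑≡sum f ⟩
  sum f                       ≡⟨ sum-remove f ⟩
  f k + sum (removeAt f k)    ≡⟨ cong (f k +_) (∑≡sum (removeAt f k)) ⟨
  f k + ∑ (removeAt f k)      ∎

∑-single : ∀ {n} {f : Fin n → ℚ} k → (∀ i → i ≢ k → f i ≡ 0ℚ) → ∑ f ≡ f k
∑-single {suc n} {f} k f≗0 = begin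
  ∑ f                      ≡⟨ ∑-remove f k ⟩
  f k + ∑ (removeAt f k)   ≡⟨ cong (f k +_) (∑-zero (λ i → f≗0 _ (punchInᵢ≢i k i))) ⟩
  f k + 0ℚ                 ≡⟨ +-identityʳ (f k) ⟩
  f k                      ∎

∑-agree-except : ∀ {n} {f g : Fin n → ℚ} k → (∀ i → i ≢ k → f i ≡ g i) →
  ∑ f + g k ≡ ∑ g + f k
∑-agree-except {suc n} {f} {g} k f≗g = begin
  ∑ f + g k                        ≡⟨ cong (_+ g k) (∑-remove f k) ⟩
  f k + ∑ (removeAt f k) + g k
    ≡⟨ cong (λ s → f k + s + g k) (∑-cong (λ i → f≗g _ (punchInᵢ≢i k i))) ⟩
  f k + ∑ (removeAt g k) + g k     ≡⟨ xy∙z≈zy∙x (f k) (∑ (removeAt g k)) (g k) ⟩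
  g k + ∑ (removeAt g k) + f k     ≡⟨ cong (_+ f k) (∑-remove g k) ⟨
  ∑ g + f k                        ∎

*-distribˡ-∑ : ∀ {n} c (f : Fin n → ℚ) → c * ∑ f ≡ ∑ (λ i → c * f i)
*-distribˡ-∑ c f = begin
  c * ∑ f                  ≡⟨ cong (c *_) (∑≡sum f) ⟩
  c * sum f                ≡⟨ *-distribˡ-sum c f ⟩
  sum (λ i → c * f i)      ≡⟨ ∑≡sum (λ i → c * f i) ⟨
  ∑ (λ i → c * f i)        ∎

*-distribʳ-∑ : ∀ {n} c (f : Fin n → ℚ) → ∑ f * c ≡ ∑ (λ i → f i * c)
*-distribʳ-∑ c f = begin
  ∑ f * c                  ≡⟨ cong (_* c) (∑≡sum f) ⟩
  sum f * c                ≡⟨ *-distribʳ-sum c f ⟩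
  sum (λ i → f i * c)      ≡⟨ ∑≡sum (λ i → f i * c) ⟨
  ∑ (λ i → f i * c)        ∎

∑-comm : ∀ {m n} (f : Fin m → Fin n → ℚ) → ∑ (λ i → ∑ (f i)) ≡ ∑ (λ j → ∑ (λ i → f i j))
∑-comm f = begin
  ∑ (λ i → ∑ (f i))              ≡⟨ ∑≡sum (λ i → ∑ (f i)) ⟩
  sum (λ i → ∑ (f i))            ≡⟨ sum-cong-≗ (λ i → ∑≡sum (f i)) ⟩
  sum (λ i → sum (f i))          ≡⟨ sum-comm f ⟩
  sum (λ j → sum (λ i → f i j))  ≡⟨ sum-cong-≗ (λ j → ∑≡sum (λ i → f i j)) ⟨
  sum (λ j → ∑ (λ i → f i j))    ≡⟨ ∑≡sum (λ j → ∑ (λ i → f i j)) ⟨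
  ∑ (λ j → ∑ (λ i → f i j))      ∎

*-cancelˡ-≡ : ∀ {p q} r → r ≢ 0ℚ → r * p ≡ r * q → p ≡ q
*-cancelˡ-≡ {p} {q} r r≢0 rp≡rq = begin
  p                  ≡⟨ *-identityˡ p ⟨
  1ℚ * p             ≡⟨ cong (_* p) (*-inverseˡ r) ⟨
  (1/ r) * r * p     ≡⟨ *-assoc (1/ r) r p ⟩
  (1/ r) * (r * p)   ≡⟨ cong ((1/ r) *_) rp≡rq ⟩
  (1/ r) * (r * q)   ≡⟨ *-assoc (1/ r) r q ⟨
  (1/ r) * r * q     ≡⟨ cong (_* q) (*-inverseˡ r) ⟩
  1ℚ * q             ≡⟨ *-identityˡ q ⟩
  q                  ∎
  where instance _ = ≢-nonZero r≢0

*-if-swap : ∀ b x y → x * (if b then y else 0ℚ) ≡ (if b then x else 0ℚ) * y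
*-if-swap true  x y = refl
*-if-swap false x y = trans (*-zeroʳ x) (sym (*-zeroˡ y))

applyAdj-cong : ∀ {n} {G G′ : Digraph n} {x : Vector n} →
  (∀ a b → G a b ≡ G′ a b) → ∀ v → applyAdj G x v ≡ applyAdj G′ x v
applyAdj-cong {x = x} G≗G′ v = ∑-cong (λ u → cong (λ b → if b then x u else 0ℚ) (G≗G′ v u))

applyAdj-adjoint : ∀ {n} (G : Digraph n) (x y : Vector n) →
  ∑ (λ v → x v * applyAdj G y v) ≡ ∑ (λ u → applyAdj (reverse G) x u * y u)
applyAdj-adjoint G x y = begin
  ∑ (λ v → x v * applyAdj G y v)
    ≡⟨ ∑-cong (λ v → *-distribˡ-∑ (x v) (λ u → if G v u then y u else 0ℚ)) ⟩
  ∑ (λ v → ∑ (λ u → x v * (if G v u then y u else 0ℚ)))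
    ≡⟨ ∑-cong (λ v → ∑-cong (λ u → *-if-swap (G v u) (x v) (y u))) ⟩
  ∑ (λ v → ∑ (λ u → (if G v u then x v else 0ℚ) * y u))
    ≡⟨ ∑-comm (λ v u → (if G v u then x v else 0ℚ) * y u) ⟩
  ∑ (λ u → ∑ (λ v → (if G v u then x v else 0ℚ) * y u))
    ≡⟨ ∑-cong (λ u → *-distribʳ-∑ (y u) (λ v → if G v u then x v else 0ℚ)) ⟨
  ∑ (λ u → applyAdj (reverse G) x u * y u) ∎

InKerDel⇒InKer : ∀ {n} {G : Digraph n} {x y : Vector n} {r} →
  InCoKer G x → x r ≢ 0ℚ → InKerDel G r y → InKer G y
InKerDel⇒InKer {G = G} {x} {y} {r} x∈coker xr≢0 y∈kerDel v with v ≟ r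
... | no v≢r   = y∈kerDel v v≢r
... | yes refl = *-cancelˡ-≡ (x r) xr≢0 (begin
  x r * applyAdj G y r                      ≡⟨ ∑-single r other-rows ⟨
  ∑ (λ v → x v * applyAdj G y v)            ≡⟨ applyAdj-adjoint G x y ⟩
  ∑ (λ u → applyAdj (reverse G) x u * y u)  ≡⟨ ∑-zero coker-rows ⟩
  0ℚ                                        ≡⟨ *-zeroʳ (x r) ⟨
  x r * 0ℚ                                  ∎)
  where
  other-rows : ∀ v → v ≢ r → x v * applyAdj G y v ≡ 0ℚ
  other-rows v v≢r = trans (cong (x v *_) (y∈kerDel v v≢r)) (*-zeroʳ (x v))
  coker-rows : ∀ u → applyAdj (reverse G) x u * y u ≡ 0ℚ
  coker-rows u = trans (cong (_* y u) (x∈coker u)) (*-zeroˡ (y u))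

InKerDel-cong : ∀ {n} {G G′ : Digraph n} {r} →
  (∀ a b → G a b ≡ G′ a b) → ∀ y → InKerDel G r y → InKerDel G′ r y
InKerDel-cong G≗G′ y y∈kerDel v v≢r = trans (sym (applyAdj-cong G≗G′ v)) (y∈kerDel v v≢r)

SpannedBy-resp : ∀ {n} {P Q : Vector n → Set} {x : Vector n} →
  (∀ y → P y → Q y) → (∀ y → Q y → P y) → SpannedBy P x → SpannedBy Q x
SpannedBy-resp {x = x} P⇒Q Q⇒P (x∈P , span) = P⇒Q x x∈P , λ y y∈Q → span y (Q⇒P y y∈Q)

SpannedBy-entry-≡ : ∀ {n} {P : Vector n → Set} {x y : Vector n} {u w v} →
  SpannedBy P x → P y → y v ≢ 0ℚ → y u ≡ y w → x u ≡ x w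
SpannedBy-entry-≡ {x = x} {y} {u} {w} {v} (_ , span) y∈P yv≢0 yu≡yw =
  *-cancelˡ-≡ c c≢0 (trans (sym (y≗cx u)) (trans yu≡yw (y≗cx w)))
  where
  c = proj₁ (span y y∈P)
  y≗cx = proj₂ (span y y∈P)
  c≢0 : c ≢ 0ℚ
  c≢0 c≡0 = yv≢0 (trans (y≗cx v) (trans (cong (_* x v) c≡0) (*-zeroˡ (x v))))

∷-full : ∀ {n} {a} {x : Vector n} → a ≢ 0ℚ → Full x → Full (a ∷ x)
∷-full a≢0 x-full zero    = a≢0
∷-full a≢0 x-full (suc v) = x-full v

dem≡-1 : ∀ {n} (G : Digraph n) r (x : Vector n) (xr≢0 : x r ≢ 0ℚ) →
  applyAdj G x r ≡ x r → dem G r x xr≢0 ≡ - 1ℚ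
dem≡-1 G r x xr≢0 Axr≡xr = cong -_ (begin
  applyAdj G x r ÷ x r  ≡⟨ cong (_÷ x r) Axr≡xr ⟩
  x r ÷ x r             ≡⟨ *-inverseʳ (x r) ⟩
  1ℚ                    ∎)
  where instance _ = ≢-nonZero xr≢0

reverse-subdivide : ∀ {n} (H : Digraph n) u₁ u₂ a b →
  reverse (subdivide H u₁ u₂) a b ≡ subdivide (reverse H) u₂ u₁ a b
reverse-subdivide H u₁ u₂ zero    zero    = refl
reverse-subdivide H u₁ u₂ zero    (suc w) = refl
reverse-subdivide H u₁ u₂ (suc v) zero    = refl
reverse-subdivide H u₁ u₂ (suc v) (suc w) =
  cong (λ b → H w v ∧ not b) (∧-comm (does (w ≟ u₁)) (does (v ≟ u₂)))

module _ {n} (H : Digraph n) (u₁ u₂ : Fin n) where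

  subdivide-arc-other : ∀ {v} → v ≢ u₁ → ∀ w → subdivide H u₁ u₂ (suc v) (suc w) ≡ H v w
  subdivide-arc-other {v} v≢u₁ w rewrite dec-false (v ≟ u₁) v≢u₁ = ∧-identityʳ (H v w)

  subdivide-arc-u₁ : ∀ {w} → w ≢ u₂ → subdivide H u₁ u₂ (suc u₁) (suc w) ≡ H u₁ w
  subdivide-arc-u₁ {w} w≢u₂ rewrite dec-true (u₁ ≟ u₁) refl | dec-false (w ≟ u₂) w≢u₂ =
    ∧-identityʳ (H u₁ w)

  subdivide-arc-u₁u₂ : subdivide H u₁ u₂ (suc u₁) (suc u₂) ≡ false
  subdivide-arc-u₁u₂ rewrite dec-true (u₁ ≟ u₁) refl | dec-true (u₂ ≟ u₂) refl = ∧-zeroʳ (H u₁ u₂)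

  subdivide-row-other : ∀ (z : Vector (suc n)) {v} → v ≢ u₁ →
    applyAdj (subdivide H u₁ u₂) z (suc v) ≡ applyAdj H (tail z) v
  subdivide-row-other z {v} v≢u₁ = begin
    applyAdj (subdivide H u₁ u₂) z (suc v)
      ≡⟨ cong₂ _+_ (cong (if_then z zero else 0ℚ) (dec-false (v ≟ u₁) v≢u₁))
                   (∑-cong (λ w → cong (if_then z (suc w) else 0ℚ) (subdivide-arc-other v≢u₁ w))) ⟩
    0ℚ + applyAdj H (tail z) v
      ≡⟨ +-identityˡ _ ⟩
    applyAdj H (tail z) v ∎

  subdivide-row-u₁ : H u₁ u₂ ≡ true → ∀ (z : Vector (suc n)) →
    applyAdj (subdivide H u₁ u₂) z (suc u₁) + z (suc u₂) ≡ z zero + applyAdj H (tail z) u₁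
  subdivide-row-u₁ arc z = begin
    applyAdj (subdivide H u₁ u₂) z (suc u₁) + z (suc u₂)
      ≡⟨ cong₂ (λ b c → (if b then z zero else 0ℚ) + ∑ f + c)
               (dec-true (u₁ ≟ u₁) refl) (cong (if_then z (suc u₂) else 0ℚ) (sym arc)) ⟩
    z zero + ∑ f + g u₂      ≡⟨ +-assoc (z zero) (∑ f) (g u₂) ⟩
    z zero + (∑ f + g u₂)    ≡⟨ cong (z zero +_) (∑-agree-except u₂ f≗g) ⟩
    z zero + (∑ g + f u₂)    ≡⟨ cong (λ b → z zero + (∑ g + (if b then z (suc u₂) else 0ℚ)))
                                     subdivide-arc-u₁u₂ ⟩
    z zero + (∑ g + 0ℚ)      ≡⟨ cong (z zero +_) (+-identityʳ (∑ g)) ⟩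
    z zero + ∑ g             ∎
    where
    f g : Vector n
    f w = if subdivide H u₁ u₂ (suc u₁) (suc w) then z (suc w) else 0ℚ
    g w = if H u₁ w then z (suc w) else 0ℚ
    f≗g : ∀ w → w ≢ u₂ → f w ≡ g w
    f≗g w w≢u₂ = cong (if_then z (suc w) else 0ℚ) (subdivide-arc-u₁ w≢u₂)

  subdivide-row-u₀ : ∀ (z : Vector (suc n)) → applyAdj (subdivide H u₁ u₂) z zero ≡ z (suc u₂)
  subdivide-row-u₀ z = begin
    0ℚ + ∑ (λ w → if does (w ≟ u₂) then z (suc w) else 0ℚ)
      ≡⟨ +-identityˡ _ ⟩
    ∑ (λ w → if does (w ≟ u₂) then z (suc w) else 0ℚ)
      ≡⟨ ∑-single u₂ (λ w w≢u₂ → cong (if_then z (suc w) else 0ℚ) (dec-false (w ≟ u₂) w≢u₂)) ⟩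
    (if does (u₂ ≟ u₂) then z (suc u₂) else 0ℚ)
      ≡⟨ cong (if_then z (suc u₂) else 0ℚ) (dec-true (u₂ ≟ u₂) refl) ⟩
    z (suc u₂) ∎

  InKerDel-subdivide⇒InKer : ∀ {x : Vector n} {z : Vector (suc n)} →
    InCoKer H x → x u₁ ≢ 0ℚ → H u₁ u₂ ≡ true → InKerDel (subdivide H u₁ u₂) zero z →
    InKer H (tail z) × z zero ≡ z (suc u₂)
  InKerDel-subdivide⇒InKer {x} {z} x∈coker xu₁≢0 arc z∈kerDel = tail∈ker , z₀≡zu₂
    where
    tail∈ker : InKer H (tail z)
    tail∈ker = InKerDel⇒InKer {G = H} {x} {tail z} x∈coker xu₁≢0
      (λ v v≢u₁ → trans (sym (subdivide-row-other z v≢u₁)) (z∈kerDel (suc v) λ ()))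
    z₀≡zu₂ : z zero ≡ z (suc u₂)
    z₀≡zu₂ = begin
      z zero                                                ≡⟨ +-identityʳ (z zero) ⟨
      z zero + 0ℚ                                           ≡⟨ cong (z zero +_) (tail∈ker u₁) ⟨
      z zero + applyAdj H (tail z) u₁                       ≡⟨ subdivide-row-u₁ arc z ⟨
      applyAdj (subdivide H u₁ u₂) z (suc u₁) + z (suc u₂)
        ≡⟨ cong (_+ z (suc u₂)) (z∈kerDel (suc u₁) λ ()) ⟩
      0ℚ + z (suc u₂)                                       ≡⟨ +-identityˡ (z (suc u₂)) ⟩
      z (suc u₂)                                            ∎

  InKer⇒InKerDel-subdivide : ∀ {y : Vector n} → H u₁ u₂ ≡ true → InKer H y →
    InKerDel (subdivide H u₁ u₂) zero (y u₂ ∷ y)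
  InKer⇒InKerDel-subdivide         arc y∈ker zero    0≢0 = contradiction refl 0≢0
  InKer⇒InKerDel-subdivide {y} arc y∈ker (suc v) _ = row (v ≟ u₁)
    where
    row : ∀ {v} → Dec (v ≡ u₁) → applyAdj (subdivide H u₁ u₂) (y u₂ ∷ y) (suc v) ≡ 0ℚ
    row {v} (no v≢u₁) = trans (subdivide-row-other (y u₂ ∷ y) v≢u₁) (y∈ker v)
    row     (yes refl) = identityˡ-unique _ (y u₂) (begin
      applyAdj (subdivide H u₁ u₂) (y u₂ ∷ y) (suc u₁) + y u₂
        ≡⟨ subdivide-row-u₁ arc (y u₂ ∷ y) ⟩
      y u₂ + applyAdj H y u₁  ≡⟨ cong (y u₂ +_) (y∈ker u₁) ⟩
      y u₂ + 0ℚ               ≡⟨ +-identityʳ (y u₂) ⟩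
      y u₂                    ∎)

  subdivide-spannedBy : ∀ {x : Vector n} → x u₁ ≢ 0ℚ → InCoKer H x → SpannedBy (InKer H) x →
    H u₁ u₂ ≡ true → SpannedBy (InKerDel (subdivide H u₁ u₂) zero) (x u₂ ∷ x)
  subdivide-spannedBy {x} xu₁≢0 x∈coker (x∈ker , span) arc =
    InKer⇒InKerDel-subdivide arc x∈ker , multiple
    where
    multiple : ∀ z → InKerDel (subdivide H u₁ u₂) zero z → ∃ λ c → ∀ v → z v ≡ c * (x u₂ ∷ x) v
    multiple z z∈kerDel with InKerDel-subdivide⇒InKer {x} {z} x∈coker xu₁≢0 arc z∈kerDel
    ... | tail∈ker , z₀≡zu₂ with span (tail z) tail∈ker
    ... | c , tail≗cx = c , λ where
      zero    → trans z₀≡zu₂ (tail≗cx u₂)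
      (suc v) → tail≗cx v

reverse-subdivide-spannedBy : ∀ {n} (H : Digraph n) u₁ u₂ {y : Vector (suc n)} →
  SpannedBy (InKerDel (subdivide (reverse H) u₂ u₁) zero) y →
  SpannedBy (InKerDel (reverse (subdivide H u₁ u₂)) zero) y
reverse-subdivide-spannedBy H u₁ u₂ = SpannedBy-resp
  (InKerDel-cong (λ a b → sym (reverse-subdivide H u₁ u₂ a b)))
  (InKerDel-cong (reverse-subdivide H u₁ u₂))

theorem36 : (m : ℕ) (H : Digraph (suc m)) → AmbiNut H →
    (x̃ : Vector (suc m)) → InKer H x̃ → (∃ λ v → x̃ v ≢ 0ℚ) →
    (u₁ u₂ : Fin (suc m)) → H u₁ u₂ ≡ true → x̃ u₁ ≡ x̃ u₂ →
    IsGadget (subdivide H u₁ u₂) zero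
    × (∀ x → (gx : GadgetVector (subdivide H u₁ u₂) zero x) →
         dem (subdivide H u₁ u₂) zero x (proj₁ gx zero) ≡ - 1ℚ)
theorem36 m H (x , x-full , x-spans-ker , x-spans-coker) x̃ x̃∈ker (_ , x̃v≢0) u₁ u₂ arc x̃u₁≡x̃u₂ =
  (x u₂ ∷ x , gadget) , demand
  where
  xu₁≡xu₂ : x u₁ ≡ x u₂
  xu₁≡xu₂ = SpannedBy-entry-≡ x-spans-ker x̃∈ker x̃v≢0 x̃u₁≡x̃u₂

  gadget : GadgetVector (subdivide H u₁ u₂) zero (x u₂ ∷ x)
  gadget = ∷-full (x-full u₂) x-full
         , subdivide-spannedBy H u₁ u₂ (x-full u₁) (proj₁ x-spans-coker) x-spans-ker arc
         , reverse-subdivide-spannedBy H u₁ u₂ (subst (λ a → SpannedBy _ (a ∷ x)) xu₁≡xu₂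
             (subdivide-spannedBy (reverse H) u₂ u₁ (x-full u₂) (proj₁ x-spans-ker) x-spans-coker arc))

  demand : ∀ z → (gz : GadgetVector (subdivide H u₁ u₂) zero z) →
    dem (subdivide H u₁ u₂) zero z (proj₁ gz zero) ≡ - 1ℚ
  demand z (z-full , (z∈kerDel , _) , _) = dem≡-1 (subdivide H u₁ u₂) zero z (z-full zero) (begin
    applyAdj (subdivide H u₁ u₂) z zero  ≡⟨ subdivide-row-u₀ H u₁ u₂ z ⟩
    z (suc u₂)                           ≡⟨ z₀≡zu₂ ⟨
    z zero                               ∎)
    where
    z₀≡zu₂ = proj₂ (InKerDel-subdivide⇒InKer H u₁ u₂ {x} {z}
                      (proj₁ x-spans-coker) (x-full u₁) arc z∈kerDel)
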